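{- Let $a_1,a_2,a_3,a_4,a_6\in\mathbb Z$ and let $E: y^2z+a_1xyz+a_3yz^2=x^3+a_2x^2z+a_4xz^2+a_6z^3$ be an elliptic curve over $\mathbb Q$ with discriminant $\Delta_E\neq0$. Let $S$ be any finite set of prime numbers, $\mathbb Z_S$ the ring of $S$-integers, and let $t=(x_t:y_t:z_t)\in E$ with $x_t,y_t,z_t$ relatively prime integers and $z_t\in\mathbb Z_S^\times$. Let $L_t(u,v)=v$ and $Q_t(u,v)=A^2-4v^2B$, where $$A=-z_tu^2+z_ta_1uv+(a_2z_t+x_t)v^2,$$ $$B=x_tz_tu^2+(2y_tz_t+z_t^2a_3)uv+(a_4z_t^2-a_1z_ty_t+a_2z_tx_t+x_t^2)v^2.$$ Let $\Delta_t$ be the discriminant of the binary quintic form $L_t(u,v)\cdot Q_t(u,v)$. Then $\Delta_t$ is a unit in $\mathbb Z_S[(2\Delta_E)^{ -1}]$.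
   Context: The points $t$ described are exactly the $\mathbb Z_S$-points of $Y$, the curve $E$ punctured at its origin $(0:1:0)$ (the complement of $z=0$). -}

module Defs where

open import Data.Nat as ℕ using (ℕ; zero; suc; _∸_; _≡ᵇ_; _<ᵇ_; _≤ᵇ_)
open import Data.Nat.Divisibility using (_∣_)
open import Data.Nat.Primality using (Prime)
open import Data.Integer using (ℤ; +_; -_; _+_; _-_; _*_; ∣_∣)
open import Data.Fin using (Fin; zero; suc; toℕ; punchIn)
open import Data.List using (List; []; _∷_; length)
open import Data.List.Membership.Propositional using (_∈_)
open import Data.Bool using (if_then_else_)
open import Data.Sum using (_⊎_)
open import Data.Product using (_×_)
open import Relation.Binary.PropositionalEquality using (_≡_)
open import Relation.Nullary using (¬_)

b₂ b₄ b₆ b₈ : ℤ → ℤ → ℤ → ℤ → ℤ → ℤ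
b₂ a₁ a₂ a₃ a₄ a₆ = a₁ * a₁ + + 4 * a₂
b₄ a₁ a₂ a₃ a₄ a₆ = + 2 * a₄ + a₁ * a₃
b₆ a₁ a₂ a₃ a₄ a₆ = a₃ * a₃ + + 4 * a₆
b₈ a₁ a₂ a₃ a₄ a₆ =
  a₁ * a₁ * a₆ + + 4 * a₂ * a₆ - a₁ * a₃ * a₄ + a₂ * a₃ * a₃ - a₄ * a₄

discE : ℤ → ℤ → ℤ → ℤ → ℤ → ℤ
discE a₁ a₂ a₃ a₄ a₆ =
  let B2 = b₂ a₁ a₂ a₃ a₄ a₆ ; B4 = b₄ a₁ a₂ a₃ a₄ a₆
      B6 = b₆ a₁ a₂ a₃ a₄ a₆ ; B8 = b₈ a₁ a₂ a₃ a₄ a₆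
  in - (B2 * B2 * B8) - + 8 * (B4 * B4 * B4) - + 27 * (B6 * B6)
     + + 9 * B2 * B4 * B6

OnCurve : ℤ → ℤ → ℤ → ℤ → ℤ → ℤ → ℤ → ℤ → Set
OnCurve a₁ a₂ a₃ a₄ a₆ x y z =
  y * y * z + a₁ * x * y * z + a₃ * y * z * z
    ≡ x * x * x + a₂ * x * x * z + a₄ * x * z * z + a₆ * z * z * z

RelPrime3 : ℤ → ℤ → ℤ → Set
RelPrime3 x y z = ∀ (d : ℕ) → d ∣ ∣ x ∣ → d ∣ ∣ y ∣ → d ∣ ∣ z ∣ → d ≡ 1

IsSUnit : List ℕ → ℤ → Set
IsSUnit S z = ¬ (z ≡ + 0) × (∀ p → Prime p → p ∣ ∣ z ∣ → p ∈ S)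

-- z is a unit of ℤ_S[m⁻¹]
IsUnitSInv : List ℕ → ℤ → ℤ → Set
IsUnitSInv S m z =
  ¬ (z ≡ + 0) × (∀ p → Prime p → p ∣ ∣ z ∣ → (p ∈ S) ⊎ (p ∣ ∣ m ∣))

-- Binary forms: a binary form of degree n is the list of its n+1
-- coefficients [c₀, c₁, …, cₙ] with F(u,v) = Σ cᵢ u^(n-i) v^i.

addF : List ℤ → List ℤ → List ℤ
addF [] q = q
addF (a ∷ p) [] = a ∷ p
addF (a ∷ p) (b ∷ q) = (a + b) ∷ addF p q

scaleF : ℤ → List ℤ → List ℤ
scaleF a [] = []
scaleF a (b ∷ q) = a * b ∷ scaleF a q

mulF : List ℤ → List ℤ → List ℤ
mulF [] q = []
mulF (a ∷ []) q = scaleF a q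
mulF (a ∷ p@(_ ∷ _)) q = addF (scaleF a q) (+ 0 ∷ mulF p q)

subF : List ℤ → List ℤ → List ℤ
subF p q = addF p (scaleF (- + 1) q)

coef : List ℤ → ℕ → ℤ
coef [] _ = + 0
coef (a ∷ p) zero = a
coef (a ∷ p) (suc i) = coef p i

-- coefficients of ∂F/∂u :  (n - i) cᵢ  for i = 0 … n-1
derivCoefs : ℕ → List ℤ → List ℤ
derivCoefs n [] = []
derivCoefs n (a ∷ []) = []
derivCoefs n (a ∷ p@(_ ∷ _)) = + n * a ∷ derivCoefs (n ∸ 1) p

sumFin : ∀ n → (Fin n → ℤ) → ℤ
sumFin zero f = + 0
sumFin (suc n) f = f zero + sumFin n (λ i → f (suc i))

sgn : ℕ → ℤ
sgn zero = + 1
sgn (suc k) = - sgn k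

det : ∀ n → (Fin n → Fin n → ℤ) → ℤ
det zero M = + 1
det (suc n) M =
  sumFin (suc n) (λ j → sgn (toℕ j) * M zero j * det n (λ i k → M (suc i) (punchIn j k)))

-- Discriminant of a binary form of degree n ≥ 2.
-- Classically Res(f, f') = (-1)^(n(n-1)/2) cₙ-leading · Disc(F), where
-- f(u) = F(u,1) taken with formal degree n and Res is the (2n-1)×(2n-1)
-- Sylvester determinant. The first column of the Sylvester matrix is
-- (c₀,0,…,0, n c₀, 0,…,0), so dividing that column by c₀ gives the
-- discriminant as a polynomial in the coefficients (valid also if c₀ = 0).

sylvMod : (c : List ℤ) → ℕ → ℕ → ℤ
sylvMod c r j =
  let n = length c ∸ 1
      d = derivCoefs n c
  in if j ≡ᵇ 0
     then (if r ≡ᵇ 0 then + 1 else if r ≡ᵇ (n ∸ 1) then + n else + 0)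
     else if r <ᵇ (n ∸ 1)
       then (if r ≤ᵇ j then coef c (j ∸ r) else + 0)
       else (let r' = r ∸ (n ∸ 1) in if r' ≤ᵇ j then coef d (j ∸ r') else + 0)

binDisc : List ℤ → ℤ
binDisc c =
  let n = length c ∸ 1
      N = (n ℕ.+ n) ∸ 1
  in sgn ((n ℕ.* (n ∸ 1)) ℕ./ 2) * det N (λ i j → sylvMod c (toℕ i) (toℕ j))

formA : ℤ → ℤ → ℤ → ℤ → ℤ → ℤ → ℤ → ℤ → List ℤ
formA a₁ a₂ a₃ a₄ a₆ x y z = (- z) ∷ z * a₁ ∷ (a₂ * z + x) ∷ []

formB : ℤ → ℤ → ℤ → ℤ → ℤ → ℤ → ℤ → ℤ → List ℤ
formB a₁ a₂ a₃ a₄ a₆ x y z =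
  x * z ∷ (+ 2 * y * z + z * z * a₃)
    ∷ (a₄ * z * z - a₁ * z * y + a₂ * z * x + x * x) ∷ []

formL : List ℤ
formL = + 0 ∷ + 1 ∷ []

formQ : ℤ → ℤ → ℤ → ℤ → ℤ → ℤ → ℤ → ℤ → List ℤ
formQ a₁ a₂ a₃ a₄ a₆ x y z =
  let A = formA a₁ a₂ a₃ a₄ a₆ x y z
      B = formB a₁ a₂ a₃ a₄ a₆ x y z
  in subF (mulF A A) (mulF (+ 0 ∷ + 0 ∷ + 4 ∷ []) B)

discT : ℤ → ℤ → ℤ → ℤ → ℤ → ℤ → ℤ → ℤ → ℤ
discT a₁ a₂ a₃ a₄ a₆ x y z = binDisc (mulF formL (formQ a₁ a₂ a₃ a₄ a₆ x y z))

{-# OPTIONS --safe #-}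
-- Δ_t is an explicit polynomial in a₁,…,a₆,x,y,z, and as a polynomial identity
--   Δ_t = 2⁸ z¹⁶ Δ_E + (y²z + a₁xyz + a₃yz² − x³ − a₂x²z − a₄xz² − a₆z³) · G
-- for an explicit cofactor G. On the curve the second term vanishes, so every
-- prime dividing Δ_t divides 2, z or Δ_E. The identity is verified by a
-- certified normaliser for integer polynomials, run on a symbolic copy of the
-- Sylvester determinant defining the discriminant.
module Submission where

open import Defs
open import Data.Nat as ℕ using (ℕ; zero; suc; _∸_; _≡ᵇ_; _<ᵇ_; _≤ᵇ_)
open import Data.Nat.Divisibility using (_∣_; ∣-trans; m∣m*n; n∣m*n; ∣1⇒≡1)
open import Data.Nat.Primality using (Prime; euclidsLemma)
open import Data.Integer using (ℤ; +_; -_; _+_; _-_; _*_; _^_; ∣_∣)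
import Data.Integer.Properties as ℤ
open import Data.Integer.Tactic.RingSolver using (solve-∀)
open import Data.Fin using (Fin; zero; suc; toℕ; punchIn)
open import Data.List using (List; []; _∷_; length; map)
open import Data.List.Properties using (length-map)
open import Data.List.Relation.Unary.All using (All)
open import Data.List.Membership.Propositional using (_∈_)
open import Data.Vec as Vec using (Vec; []; _∷_; lookup)
open import Data.Vec.Properties using (lookup-map)
open import Data.Bool using (Bool; true; false; if_then_else_; _∨_; _∧_)
open import Data.Sum using (_⊎_; inj₁; inj₂)
open import Data.Product using (_,_)
open import Relation.Binary.PropositionalEquality
  using (_≡_; refl; sym; trans; cong; cong₂; subst; module ≡-Reasoning)
open import Relation.Nullary using (¬_)

infixl 6 _:+_
infixl 7 _:*_
infix 8 :-_

data Expr (n : ℕ) : Set where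
  con  : ℤ → Expr n
  var  : Fin n → Expr n
  _:+_ : Expr n → Expr n → Expr n
  _:*_ : Expr n → Expr n → Expr n
  :-_  : Expr n → Expr n

⟦_⟧ : ∀ {n} → Expr n → Vec ℤ n → ℤ
⟦ con k ⟧   ρ = k
⟦ var i ⟧   ρ = lookup ρ i
⟦ a :+ b ⟧  ρ = ⟦ a ⟧ ρ + ⟦ b ⟧ ρ
⟦ a :* b ⟧  ρ = ⟦ a ⟧ ρ * ⟦ b ⟧ ρ
⟦ :- a ⟧    ρ = - ⟦ a ⟧ ρ

eval : ∀ {n} → Vec ℤ n → Expr n → ℤ
eval ρ e = ⟦ e ⟧ ρ

_:^_ : ∀ {n} → Expr n → ℕ → Expr n
e :^ zero  = con (+ 1)
e :^ suc k = e :* e :^ k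

⟦:^⟧ : ∀ {n} (e : Expr n) k ρ → ⟦ e :^ k ⟧ ρ ≡ ⟦ e ⟧ ρ ^ k
⟦:^⟧ e zero    ρ = refl
⟦:^⟧ e (suc k) ρ = cong (⟦ e ⟧ ρ *_) (⟦:^⟧ e k ρ)

_[_] : ∀ {m n} → Expr m → Vec (Expr n) m → Expr n
con k    [ σ ] = con k
var i    [ σ ] = lookup σ i
(a :+ b) [ σ ] = a [ σ ] :+ b [ σ ]
(a :* b) [ σ ] = a [ σ ] :* b [ σ ]
(:- a)   [ σ ] = :- a [ σ ]

⟦⟧-substitute : ∀ {m n} (e : Expr m) (σ : Vec (Expr n) m) ρ →
                ⟦ e [ σ ] ⟧ ρ ≡ ⟦ e ⟧ (Vec.map (eval ρ) σ)
⟦⟧-substitute (con k)  σ ρ = refl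
⟦⟧-substitute (var i)  σ ρ = sym (lookup-map i _ σ)
⟦⟧-substitute (a :+ b) σ ρ = cong₂ _+_ (⟦⟧-substitute a σ ρ) (⟦⟧-substitute b σ ρ)
⟦⟧-substitute (a :* b) σ ρ = cong₂ _*_ (⟦⟧-substitute a σ ρ) (⟦⟧-substitute b σ ρ)
⟦⟧-substitute (:- a)   σ ρ = cong -_ (⟦⟧-substitute a σ ρ)

-- Horner normal form: a polynomial in n+1 variables is the list of its
-- coefficients (polynomials in the last n variables) in powers of the first.
Poly : ℕ → Set
Poly zero    = ℤ
Poly (suc n) = List (Poly n)

⟦_⟧ₚ : ∀ {n} → Poly n → Vec ℤ n → ℤ
⟦_⟧ₚ {zero}  k       ρ       = k
⟦_⟧ₚ {suc n} []      ρ       = + 0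
⟦_⟧ₚ {suc n} (a ∷ p) (x ∷ ρ) = ⟦ a ⟧ₚ ρ + x * ⟦ p ⟧ₚ (x ∷ ρ)

zeroₚ : ∀ {n} → Poly n
zeroₚ {zero}  = + 0
zeroₚ {suc n} = []

constₚ : ∀ {n} → ℤ → Poly n
constₚ {zero}  k = k
constₚ {suc n} k = constₚ k ∷ []

varₚ : ∀ {n} → Fin n → Poly n
varₚ {suc n} zero    = zeroₚ ∷ constₚ (+ 1) ∷ []
varₚ {suc n} (suc i) = varₚ i ∷ []

addₚ : ∀ n → Poly n → Poly n → Poly n
addₗ : ∀ n → List (Poly n) → List (Poly n) → List (Poly n)
addₚ zero    a b = a + b
addₚ (suc n) p q = addₗ n p q
addₗ n []      q       = q
addₗ n (a ∷ p) []      = a ∷ p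
addₗ n (a ∷ p) (b ∷ q) = addₚ n a b ∷ addₗ n p q

negₚ : ∀ n → Poly n → Poly n
negₗ : ∀ n → List (Poly n) → List (Poly n)
negₚ zero    a = - a
negₚ (suc n) p = negₗ n p
negₗ n []      = []
negₗ n (a ∷ p) = negₚ n a ∷ negₗ n p

mulₚ   : ∀ n → Poly n → Poly n → Poly n
scaleₗ : ∀ n → Poly n → List (Poly n) → List (Poly n)
mulₗ   : ∀ n → List (Poly n) → List (Poly n) → List (Poly n)
mulₚ zero    a b = a * b
mulₚ (suc n) p q = mulₗ n p q
scaleₗ n a []      = []
scaleₗ n a (b ∷ q) = mulₚ n a b ∷ scaleₗ n a q
mulₗ n []      q = []
mulₗ n (a ∷ p) q = addₗ n (scaleₗ n a q) (zeroₚ ∷ mulₗ n p q)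

normalise : ∀ {n} → Expr n → Poly n
normalise {n} (con k)  = constₚ k
normalise {n} (var i)  = varₚ i
normalise {n} (a :+ b) = addₚ n (normalise a) (normalise b)
normalise {n} (a :* b) = mulₚ n (normalise a) (normalise b)
normalise {n} (:- a)   = negₚ n (normalise a)

isZeroₚ : ∀ n → Poly n → Bool
isZeroₗ : ∀ n → List (Poly n) → Bool
isZeroₚ zero    (+ zero) = true
isZeroₚ zero    _        = false
isZeroₚ (suc n) p        = isZeroₗ n p
isZeroₗ n []      = true
isZeroₗ n (a ∷ p) = isZeroₚ n a ∧ isZeroₗ n p

zeroₚ-sound : ∀ n (ρ : Vec ℤ n) → ⟦ zeroₚ {n} ⟧ₚ ρ ≡ + 0
zeroₚ-sound zero    ρ = refl
zeroₚ-sound (suc n) ρ = refl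

constₚ-sound : ∀ n k (ρ : Vec ℤ n) → ⟦ constₚ k ⟧ₚ ρ ≡ k
constₚ-sound zero    k ρ       = refl
constₚ-sound (suc n) k (x ∷ ρ) rewrite constₚ-sound n k ρ | ℤ.*-zeroʳ x = ℤ.+-identityʳ k

varₚ-sound : ∀ n i (ρ : Vec ℤ n) → ⟦ varₚ i ⟧ₚ ρ ≡ lookup ρ i
varₚ-sound (suc n) zero (x ∷ ρ)
  rewrite zeroₚ-sound n ρ | constₚ-sound n (+ 1) ρ | ℤ.*-zeroʳ x = lemma x
  where
  lemma : ∀ x → + 0 + x * (+ 1 + + 0) ≡ x
  lemma = solve-∀
varₚ-sound (suc n) (suc i) (x ∷ ρ)
  rewrite varₚ-sound n i ρ | ℤ.*-zeroʳ x = ℤ.+-identityʳ _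

addₚ-sound : ∀ n p q (ρ : Vec ℤ n) → ⟦ addₚ n p q ⟧ₚ ρ ≡ ⟦ p ⟧ₚ ρ + ⟦ q ⟧ₚ ρ
addₗ-sound : ∀ n p q x (ρ : Vec ℤ n) →
             ⟦ addₗ n p q ⟧ₚ (x ∷ ρ) ≡ ⟦ p ⟧ₚ (x ∷ ρ) + ⟦ q ⟧ₚ (x ∷ ρ)
addₚ-sound zero    p q ρ       = refl
addₚ-sound (suc n) p q (x ∷ ρ) = addₗ-sound n p q x ρ
addₗ-sound n []      q       x ρ = sym (ℤ.+-identityˡ _)
addₗ-sound n (a ∷ p) []      x ρ = sym (ℤ.+-identityʳ _)
addₗ-sound n (a ∷ p) (b ∷ q) x ρ
  rewrite addₚ-sound n a b ρ | addₗ-sound n p q x ρ =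
  lemma (⟦ a ⟧ₚ ρ) (⟦ b ⟧ₚ ρ) x (⟦ p ⟧ₚ (x ∷ ρ)) (⟦ q ⟧ₚ (x ∷ ρ))
  where
  lemma : ∀ a b x p q → a + b + x * (p + q) ≡ a + x * p + (b + x * q)
  lemma = solve-∀

negₚ-sound : ∀ n p (ρ : Vec ℤ n) → ⟦ negₚ n p ⟧ₚ ρ ≡ - ⟦ p ⟧ₚ ρ
negₗ-sound : ∀ n p x (ρ : Vec ℤ n) → ⟦ negₗ n p ⟧ₚ (x ∷ ρ) ≡ - ⟦ p ⟧ₚ (x ∷ ρ)
negₚ-sound zero    p ρ       = refl
negₚ-sound (suc n) p (x ∷ ρ) = negₗ-sound n p x ρ
negₗ-sound n []      x ρ = refl
negₗ-sound n (a ∷ p) x ρ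
  rewrite negₚ-sound n a ρ | negₗ-sound n p x ρ = lemma (⟦ a ⟧ₚ ρ) x (⟦ p ⟧ₚ (x ∷ ρ))
  where
  lemma : ∀ a x p → - a + x * - p ≡ - (a + x * p)
  lemma = solve-∀

mulₚ-sound   : ∀ n p q (ρ : Vec ℤ n) → ⟦ mulₚ n p q ⟧ₚ ρ ≡ ⟦ p ⟧ₚ ρ * ⟦ q ⟧ₚ ρ
scaleₗ-sound : ∀ n a q x (ρ : Vec ℤ n) →
               ⟦ scaleₗ n a q ⟧ₚ (x ∷ ρ) ≡ ⟦ a ⟧ₚ ρ * ⟦ q ⟧ₚ (x ∷ ρ)
mulₗ-sound   : ∀ n p q x (ρ : Vec ℤ n) →
               ⟦ mulₗ n p q ⟧ₚ (x ∷ ρ) ≡ ⟦ p ⟧ₚ (x ∷ ρ) * ⟦ q ⟧ₚ (x ∷ ρ)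
mulₚ-sound zero    p q ρ       = refl
mulₚ-sound (suc n) p q (x ∷ ρ) = mulₗ-sound n p q x ρ
scaleₗ-sound n a []      x ρ = sym (ℤ.*-zeroʳ (⟦ a ⟧ₚ ρ))
scaleₗ-sound n a (b ∷ q) x ρ
  rewrite mulₚ-sound n a b ρ | scaleₗ-sound n a q x ρ =
  lemma (⟦ a ⟧ₚ ρ) (⟦ b ⟧ₚ ρ) x (⟦ q ⟧ₚ (x ∷ ρ))
  where
  lemma : ∀ a b x q → a * b + x * (a * q) ≡ a * (b + x * q)
  lemma = solve-∀
mulₗ-sound n []      q x ρ = refl
mulₗ-sound n (a ∷ p) q x ρ
  rewrite addₗ-sound n (scaleₗ n a q) (zeroₚ ∷ mulₗ n p q) x ρ
        | scaleₗ-sound n a q x ρ | zeroₚ-sound n ρ | mulₗ-sound n p q x ρ =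
  lemma (⟦ a ⟧ₚ ρ) x (⟦ p ⟧ₚ (x ∷ ρ)) (⟦ q ⟧ₚ (x ∷ ρ))
  where
  lemma : ∀ a x p q → a * q + (+ 0 + x * (p * q)) ≡ (a + x * p) * q
  lemma = solve-∀

normalise-sound : ∀ {n} (e : Expr n) ρ → ⟦ normalise e ⟧ₚ ρ ≡ ⟦ e ⟧ ρ
normalise-sound {n} (con k)  ρ = constₚ-sound n k ρ
normalise-sound {n} (var i)  ρ = varₚ-sound n i ρ
normalise-sound {n} (a :+ b) ρ =
  trans (addₚ-sound n _ _ ρ) (cong₂ _+_ (normalise-sound a ρ) (normalise-sound b ρ))
normalise-sound {n} (a :* b) ρ =
  trans (mulₚ-sound n _ _ ρ) (cong₂ _*_ (normalise-sound a ρ) (normalise-sound b ρ))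
normalise-sound {n} (:- a)   ρ = trans (negₚ-sound n _ ρ) (cong -_ (normalise-sound a ρ))

isZeroₚ-sound : ∀ n p (ρ : Vec ℤ n) → isZeroₚ n p ≡ true → ⟦ p ⟧ₚ ρ ≡ + 0
isZeroₗ-sound : ∀ n p x (ρ : Vec ℤ n) → isZeroₗ n p ≡ true → ⟦ p ⟧ₚ (x ∷ ρ) ≡ + 0
isZeroₚ-sound zero    (+ zero) ρ       _  = refl
isZeroₚ-sound (suc n) p        (x ∷ ρ) eq = isZeroₗ-sound n p x ρ eq
isZeroₗ-sound n []      x ρ _ = refl
isZeroₗ-sound n (a ∷ p) x ρ eq with isZeroₚ n a in a≈0
... | true rewrite isZeroₚ-sound n a ρ a≈0 | isZeroₗ-sound n p x ρ eq | ℤ.*-zeroʳ x = refl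

⟦⟧-≡-by-normalise : ∀ {n} (a b : Expr n) → isZeroₚ n (normalise (a :+ :- b)) ≡ true →
                    ∀ ρ → ⟦ a ⟧ ρ ≡ ⟦ b ⟧ ρ
⟦⟧-≡-by-normalise {n} a b a-b≈0 ρ = ℤ.i-j≡0⇒i≡j _ _
  (trans (sym (normalise-sound (a :+ :- b) ρ)) (isZeroₚ-sound n _ ρ a-b≈0))

module _ {m : ℕ} where

  isSyntacticZero : Expr m → Bool
  isSyntacticZero (con (+ zero)) = true
  isSyntacticZero (a :* b)       = isSyntacticZero a ∨ isSyntacticZero b
  isSyntacticZero _              = false

  sumFinₑ : ∀ n → (Fin n → Expr m) → Expr m
  sumFinₑ zero    f = con (+ 0)
  sumFinₑ (suc n) f = f zero :+ sumFinₑ n (λ i → f (suc i))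

  -- Laplace expansion skipping syntactically zero entries; without the
  -- pruning the expanded 9×9 Sylvester determinant is far too large.
  detₑ : ∀ n → (Fin n → Fin n → Expr m) → Expr m
  detₑ zero    M = con (+ 1)
  detₑ (suc n) M = sumFinₑ (suc n) λ j →
    if isSyntacticZero (M zero j) then con (+ 0)
    else con (sgn (toℕ j)) :* M zero j :* detₑ n (λ i k → M (suc i) (punchIn j k))

  coefₑ : List (Expr m) → ℕ → Expr m
  coefₑ []      _       = con (+ 0)
  coefₑ (a ∷ p) zero    = a
  coefₑ (a ∷ p) (suc i) = coefₑ p i

  derivCoefsₑ : ℕ → List (Expr m) → List (Expr m)
  derivCoefsₑ n []                = []
  derivCoefsₑ n (a ∷ [])          = []
  derivCoefsₑ n (a ∷ p@(_ ∷ _))   = con (+ n) :* a ∷ derivCoefsₑ (n ∸ 1) p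

  sylvModₑ : ℕ → List (Expr m) → ℕ → ℕ → Expr m
  sylvModₑ n c r j =
    if j ≡ᵇ 0
    then (if r ≡ᵇ 0 then con (+ 1) else if r ≡ᵇ (n ∸ 1) then con (+ n) else con (+ 0))
    else if r <ᵇ (n ∸ 1)
      then (if r ≤ᵇ j then coefₑ c (j ∸ r) else con (+ 0))
      else (if r ∸ (n ∸ 1) ≤ᵇ j then coefₑ (derivCoefsₑ n c) (j ∸ (r ∸ (n ∸ 1)))
            else con (+ 0))

  binDiscOfDegreeₑ : ℕ → List (Expr m) → Expr m
  binDiscOfDegreeₑ n c =
    con (sgn ((n ℕ.* (n ∸ 1)) ℕ./ 2))
    :* detₑ ((n ℕ.+ n) ∸ 1) (λ i j → sylvModₑ n c (toℕ i) (toℕ j))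

  binDiscₑ : List (Expr m) → Expr m
  binDiscₑ c = binDiscOfDegreeₑ (length c ∸ 1) c

  addFₑ : List (Expr m) → List (Expr m) → List (Expr m)
  addFₑ []      q       = q
  addFₑ (a ∷ p) []      = a ∷ p
  addFₑ (a ∷ p) (b ∷ q) = a :+ b ∷ addFₑ p q

  scaleFₑ : Expr m → List (Expr m) → List (Expr m)
  scaleFₑ a []      = []
  scaleFₑ a (b ∷ q) = a :* b ∷ scaleFₑ a q

  mulFₑ : List (Expr m) → List (Expr m) → List (Expr m)
  mulFₑ []              q = []
  mulFₑ (a ∷ [])        q = scaleFₑ a q
  mulFₑ (a ∷ p@(_ ∷ _)) q = addFₑ (scaleFₑ a q) (con (+ 0) ∷ mulFₑ p q)

  subFₑ : List (Expr m) → List (Expr m) → List (Expr m)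
  subFₑ p q = addFₑ p (scaleFₑ (con (- + 1)) q)

sumFin-cong : ∀ n {f g : Fin n → ℤ} → (∀ i → f i ≡ g i) → sumFin n f ≡ sumFin n g
sumFin-cong zero    f≗g = refl
sumFin-cong (suc n) f≗g = cong₂ _+_ (f≗g zero) (sumFin-cong n (λ i → f≗g (suc i)))

det-cong : ∀ n {M N : Fin n → Fin n → ℤ} → (∀ i j → M i j ≡ N i j) → det n M ≡ det n N
det-cong zero    M≗N = refl
det-cong (suc n) M≗N = sumFin-cong (suc n) λ j →
  cong₂ (λ a b → sgn (toℕ j) * a * b) (M≗N zero j)
        (det-cong n (λ i k → M≗N (suc i) (punchIn j k)))

module _ {m : ℕ} (ρ : Vec ℤ m) where

  isSyntacticZero-sound : ∀ e → isSyntacticZero e ≡ true → ⟦ e ⟧ ρ ≡ + 0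
  isSyntacticZero-sound (con (+ zero)) _ = refl
  isSyntacticZero-sound (a :* b) a*b≈0 with isSyntacticZero a in a≈0
  ... | true  rewrite isSyntacticZero-sound a a≈0 = refl
  ... | false rewrite isSyntacticZero-sound b a*b≈0 = ℤ.*-zeroʳ (⟦ a ⟧ ρ)

  sumFin-⟦⟧ : ∀ n (f : Fin n → Expr m) → sumFin n (λ i → ⟦ f i ⟧ ρ) ≡ ⟦ sumFinₑ n f ⟧ ρ
  sumFin-⟦⟧ zero    f = refl
  sumFin-⟦⟧ (suc n) f = cong (λ s → ⟦ f zero ⟧ ρ + s) (sumFin-⟦⟧ n (λ i → f (suc i)))

  det-⟦⟧ : ∀ n (M : Fin n → Fin n → Expr m) → det n (λ i j → ⟦ M i j ⟧ ρ) ≡ ⟦ detₑ n M ⟧ ρ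
  det-⟦⟧ zero    M = refl
  det-⟦⟧ (suc n) M = trans (sumFin-cong (suc n) expansion-term) (sumFin-⟦⟧ (suc n) expansion)
    where
    expansion : Fin (suc n) → Expr m
    expansion j = if isSyntacticZero (M zero j) then con (+ 0)
      else con (sgn (toℕ j)) :* M zero j :* detₑ n (λ i k → M (suc i) (punchIn j k))

    expansion-term : ∀ j →
      sgn (toℕ j) * ⟦ M zero j ⟧ ρ * det n (λ i k → ⟦ M (suc i) (punchIn j k) ⟧ ρ)
      ≡ ⟦ expansion j ⟧ ρ
    expansion-term j with isSyntacticZero (M zero j) in M₀ⱼ≈0
    ... | true  rewrite isSyntacticZero-sound (M zero j) M₀ⱼ≈0 | ℤ.*-zeroʳ (sgn (toℕ j)) = refl
    ... | false = cong (sgn (toℕ j) * ⟦ M zero j ⟧ ρ *_) (det-⟦⟧ n _)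

  coef-⟦⟧ : ∀ c i → coef (map (eval ρ) c) i ≡ ⟦ coefₑ c i ⟧ ρ
  coef-⟦⟧ []      i       = refl
  coef-⟦⟧ (a ∷ p) zero    = refl
  coef-⟦⟧ (a ∷ p) (suc i) = coef-⟦⟧ p i

  derivCoefs-⟦⟧ : ∀ n c → derivCoefs n (map (eval ρ) c) ≡ map (eval ρ) (derivCoefsₑ n c)
  derivCoefs-⟦⟧ n []          = refl
  derivCoefs-⟦⟧ n (a ∷ [])    = refl
  derivCoefs-⟦⟧ n (a ∷ b ∷ p) = cong (+ n * ⟦ a ⟧ ρ ∷_) (derivCoefs-⟦⟧ (n ∸ 1) (b ∷ p))

  sylvMod-⟦⟧ : ∀ c r j → let n = length (map (eval ρ) c) ∸ 1 in
               sylvMod (map (eval ρ) c) r j ≡ ⟦ sylvModₑ n c r j ⟧ ρ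
  sylvMod-⟦⟧ c r j with j ≡ᵇ 0
  ... | true with r ≡ᵇ 0
  ...   | true  = refl
  ...   | false with r ≡ᵇ (length (map (eval ρ) c) ∸ 1 ∸ 1)
  ...     | true  = refl
  ...     | false = refl
  sylvMod-⟦⟧ c r j | false with r <ᵇ (length (map (eval ρ) c) ∸ 1 ∸ 1)
  ...   | true with r ≤ᵇ j
  ...     | true  = coef-⟦⟧ c (j ∸ r)
  ...     | false = refl
  sylvMod-⟦⟧ c r j | false | false with r ∸ (length (map (eval ρ) c) ∸ 1 ∸ 1) ≤ᵇ j
  ...     | true  = trans (cong (λ d → coef d i) (derivCoefs-⟦⟧ n c)) (coef-⟦⟧ (derivCoefsₑ n c) i)
    where
    n = length (map (eval ρ) c) ∸ 1
    i = j ∸ (r ∸ (n ∸ 1))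
  ...     | false = refl

  binDisc-⟦⟧ : ∀ c → binDisc (map (eval ρ) c) ≡ ⟦ binDiscₑ c ⟧ ρ
  binDisc-⟦⟧ c = trans
    (cong (sgn ((n ℕ.* (n ∸ 1)) ℕ./ 2) *_)
      (trans (det-cong N (λ i j → sylvMod-⟦⟧ c (toℕ i) (toℕ j)))
             (det-⟦⟧ N (λ i j → sylvModₑ n c (toℕ i) (toℕ j)))))
    (cong (λ k → ⟦ binDiscOfDegreeₑ (k ∸ 1) c ⟧ ρ) (length-map (eval ρ) c))
    where
    n = length (map (eval ρ) c) ∸ 1
    N = (n ℕ.+ n) ∸ 1

-- Discriminant of the quintic v · (q₀u⁴ + q₁u³v + q₂u²v² + q₃uv³ + q₄v⁴), as a
-- polynomial in q₀,…,q₄; it equals q₀² · Disc(q₀u⁴ + … + q₄v⁴).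
discVTimesQuartic : Expr 5
discVTimesQuartic =
  con (+ 1)    :* q₀ :^ 2 :* q₁ :^ 2 :* q₂ :^ 2 :* q₃ :^ 2 :+
  con (- + 4)  :* q₀ :^ 2 :* q₁ :^ 2 :* q₂ :^ 3 :* q₄ :^ 1 :+
  con (- + 4)  :* q₀ :^ 2 :* q₁ :^ 3 :* q₃ :^ 3 :+
  con (+ 18)   :* q₀ :^ 2 :* q₁ :^ 3 :* q₂ :^ 1 :* q₃ :^ 1 :* q₄ :^ 1 :+
  con (- + 27) :* q₀ :^ 2 :* q₁ :^ 4 :* q₄ :^ 2 :+
  con (- + 4)  :* q₀ :^ 3 :* q₂ :^ 3 :* q₃ :^ 2 :+
  con (+ 16)   :* q₀ :^ 3 :* q₂ :^ 4 :* q₄ :^ 1 :+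
  con (+ 18)   :* q₀ :^ 3 :* q₁ :^ 1 :* q₂ :^ 1 :* q₃ :^ 3 :+
  con (- + 80) :* q₀ :^ 3 :* q₁ :^ 1 :* q₂ :^ 2 :* q₃ :^ 1 :* q₄ :^ 1 :+
  con (- + 6)  :* q₀ :^ 3 :* q₁ :^ 2 :* q₃ :^ 2 :* q₄ :^ 1 :+
  con (+ 144)  :* q₀ :^ 3 :* q₁ :^ 2 :* q₂ :^ 1 :* q₄ :^ 2 :+
  con (- + 27) :* q₀ :^ 4 :* q₃ :^ 4 :+
  con (+ 144)  :* q₀ :^ 4 :* q₂ :^ 1 :* q₃ :^ 2 :* q₄ :^ 1 :+
  con (- + 128) :* q₀ :^ 4 :* q₂ :^ 2 :* q₄ :^ 2 :+
  con (- + 192) :* q₀ :^ 4 :* q₁ :^ 1 :* q₃ :^ 1 :* q₄ :^ 2 :+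
  con (+ 256)  :* q₀ :^ 5 :* q₄ :^ 3
  where
  q₀ q₁ q₂ q₃ q₄ : Expr 5
  q₀ = var zero
  q₁ = var (suc zero)
  q₂ = var (suc (suc zero))
  q₃ = var (suc (suc (suc zero)))
  q₄ = var (suc (suc (suc (suc zero))))

vTimesQuarticₑ : List (Expr 5)
vTimesQuarticₑ = mulFₑ (con (+ 0) ∷ con (+ 1) ∷ [])
  (var zero ∷ var (suc zero) ∷ var (suc (suc zero)) ∷ var (suc (suc (suc zero)))
   ∷ var (suc (suc (suc (suc zero)))) ∷ [])

-- The implicit arguments of cong are given: inferring them would make Agda
-- unfold binDisc, a 9×9 determinant, on both sides.
binDisc-vTimesQuartic : ∀ q₀ q₁ q₂ q₃ q₄ →
  binDisc (mulF formL (q₀ ∷ q₁ ∷ q₂ ∷ q₃ ∷ q₄ ∷ []))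
    ≡ ⟦ discVTimesQuartic ⟧ (q₀ ∷ q₁ ∷ q₂ ∷ q₃ ∷ q₄ ∷ [])
binDisc-vTimesQuartic q₀ q₁ q₂ q₃ q₄ = begin
  binDisc (mulF formL (q₀ ∷ q₁ ∷ q₂ ∷ q₃ ∷ q₄ ∷ []))
    ≡⟨ cong binDisc {x = mulF formL (q₀ ∷ q₁ ∷ q₂ ∷ q₃ ∷ q₄ ∷ [])}
                    {y = map (eval ρ) vTimesQuarticₑ} refl ⟩
  binDisc (map (eval ρ) vTimesQuarticₑ)
    ≡⟨ binDisc-⟦⟧ ρ vTimesQuarticₑ ⟩
  ⟦ binDiscₑ vTimesQuarticₑ ⟧ ρ
    ≡⟨ ⟦⟧-≡-by-normalise (binDiscₑ vTimesQuarticₑ) discVTimesQuartic refl ρ ⟩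
  ⟦ discVTimesQuartic ⟧ ρ ∎
  where
  open ≡-Reasoning
  ρ : Vec ℤ 5
  ρ = q₀ ∷ q₁ ∷ q₂ ∷ q₃ ∷ q₄ ∷ []

module WeierstrassExpr where
  A₁ A₂ A₃ A₄ A₆ X Y Z : Expr 8
  A₁ = var zero
  A₂ = var (suc zero)
  A₃ = var (suc (suc zero))
  A₄ = var (suc (suc (suc zero)))
  A₆ = var (suc (suc (suc (suc zero))))
  X  = var (suc (suc (suc (suc (suc zero)))))
  Y  = var (suc (suc (suc (suc (suc (suc zero))))))
  Z  = var (suc (suc (suc (suc (suc (suc (suc zero)))))))

  formQₑ : List (Expr 8)
  formQₑ = subFₑ (mulFₑ formAₑ formAₑ) (mulFₑ (con (+ 0) ∷ con (+ 0) ∷ con (+ 4) ∷ []) formBₑ)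
    where
    formAₑ formBₑ : List (Expr 8)
    formAₑ = :- Z ∷ Z :* A₁ ∷ A₂ :* Z :+ X ∷ []
    formBₑ = X :* Z ∷ con (+ 2) :* Y :* Z :+ Z :* Z :* A₃
      ∷ A₄ :* Z :* Z :+ :- (A₁ :* Z :* Y) :+ A₂ :* Z :* X :+ X :* X ∷ []

  discEₑ : Expr 8
  discEₑ = :- (B₂ :* B₂ :* B₈) :+ :- (con (+ 8) :* (B₄ :* B₄ :* B₄))
           :+ :- (con (+ 27) :* (B₆ :* B₆)) :+ con (+ 9) :* B₂ :* B₄ :* B₆
    where
    B₂ B₄ B₆ B₈ : Expr 8
    B₂ = A₁ :* A₁ :+ con (+ 4) :* A₂
    B₄ = con (+ 2) :* A₄ :+ A₁ :* A₃
    B₆ = A₃ :* A₃ :+ con (+ 4) :* A₆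
    B₈ = A₁ :* A₁ :* A₆ :+ con (+ 4) :* A₂ :* A₆ :+ :- (A₁ :* A₃ :* A₄)
         :+ A₂ :* A₃ :* A₃ :+ :- (A₄ :* A₄)

  weierstrassDefect : Expr 8
  weierstrassDefect =
    Y :* Y :* Z :+ A₁ :* X :* Y :* Z :+ A₃ :* Y :* Z :* Z
    :+ :- (X :* X :* X :+ A₂ :* X :* X :* Z :+ A₄ :* X :* Z :* Z :+ A₆ :* Z :* Z :* Z)

  -- The polynomial quotient (Δ_t − 2⁸ z¹⁶ Δ_E) / weierstrassDefect.
  defectCofactor : Expr 8
  defectCofactor =
    con (- + 110592) :* A₆ :^ 1 :* Z :^ 13 :+
    con (- + 256)    :* A₁ :^ 6 :* Z :^ 13 :+
    con (- + 3072)   :* A₁ :^ 4 :* A₂ :^ 1 :* Z :^ 13 :+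
    con (+ 9216)     :* A₁ :^ 3 :* A₃ :^ 1 :* Z :^ 13 :+
    con (- + 12288)  :* A₁ :^ 2 :* A₂ :^ 2 :* Z :^ 13 :+
    con (+ 18432)    :* A₁ :^ 2 :* A₄ :^ 1 :* Z :^ 13 :+
    con (+ 36864)    :* A₁ :^ 1 :* A₂ :^ 1 :* A₃ :^ 1 :* Z :^ 13 :+
    con (- + 16384)  :* A₂ :^ 3 :* Z :^ 13 :+
    con (+ 73728)    :* A₂ :^ 1 :* A₄ :^ 1 :* Z :^ 13 :+
    con (- + 55296)  :* A₃ :^ 2 :* Z :^ 13 :+
    con (- + 110592) :* A₃ :^ 1 :* Y :^ 1 :* Z :^ 12 :+
    con (+ 110592)   :* A₄ :^ 1 :* X :^ 1 :* Z :^ 12 :+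
    con (- + 110592) :* A₁ :^ 1 :* X :^ 1 :* Y :^ 1 :* Z :^ 11 :+
    con (+ 110592)   :* A₂ :^ 1 :* X :^ 2 :* Z :^ 11 :+
    con (- + 110592) :* Y :^ 2 :* Z :^ 11 :+
    con (+ 110592)   :* X :^ 3 :* Z :^ 10


module _ (a₁ a₂ a₃ a₄ a₆ x y z : ℤ) where
  open WeierstrassExpr

  private
    ρ : Vec ℤ 8
    ρ = a₁ ∷ a₂ ∷ a₃ ∷ a₄ ∷ a₆ ∷ x ∷ y ∷ z ∷ []

    Q : ℕ → Expr 8
    Q = coefₑ formQₑ

    quarticₑ : Vec (Expr 8) 5
    quarticₑ = Q 0 ∷ Q 1 ∷ Q 2 ∷ Q 3 ∷ Q 4 ∷ []

  -- Each rewriting step gives its endpoints explicitly: left to unification,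
  -- the integer arithmetic hidden in ⟦_⟧ would be unfolded exponentially.
  discT≡2⁸z¹⁶discE+defect*cofactor :
    discT a₁ a₂ a₃ a₄ a₆ x y z
      ≡ (+ 2) ^ 8 * z ^ 16 * discE a₁ a₂ a₃ a₄ a₆ + ⟦ weierstrassDefect ⟧ ρ * ⟦ defectCofactor ⟧ ρ
  discT≡2⁸z¹⁶discE+defect*cofactor = begin
    binDisc (mulF formL (formQ a₁ a₂ a₃ a₄ a₆ x y z))
      ≡⟨ cong binDisc {x = mulF formL (formQ a₁ a₂ a₃ a₄ a₆ x y z)}
                      {y = mulF formL (eval ρ (Q 0) ∷ eval ρ (Q 1) ∷ eval ρ (Q 2) ∷ eval ρ (Q 3) ∷ eval ρ (Q 4) ∷ [])}
                      refl ⟩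
    binDisc (mulF formL (eval ρ (Q 0) ∷ eval ρ (Q 1) ∷ eval ρ (Q 2) ∷ eval ρ (Q 3) ∷ eval ρ (Q 4) ∷ []))
      ≡⟨ binDisc-vTimesQuartic (eval ρ (Q 0)) (eval ρ (Q 1)) (eval ρ (Q 2)) (eval ρ (Q 3)) (eval ρ (Q 4)) ⟩
    ⟦ discVTimesQuartic ⟧ (eval ρ (Q 0) ∷ eval ρ (Q 1) ∷ eval ρ (Q 2) ∷ eval ρ (Q 3) ∷ eval ρ (Q 4) ∷ [])
      ≡⟨ cong (λ qs → ⟦ discVTimesQuartic ⟧ qs)
              {x = eval ρ (Q 0) ∷ eval ρ (Q 1) ∷ eval ρ (Q 2) ∷ eval ρ (Q 3) ∷ eval ρ (Q 4) ∷ []}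
              {y = Vec.map (eval ρ) quarticₑ} refl ⟩
    ⟦ discVTimesQuartic ⟧ (Vec.map (eval ρ) quarticₑ)
      ≡⟨ ⟦⟧-substitute discVTimesQuartic quarticₑ ρ ⟨
    ⟦ discVTimesQuartic [ quarticₑ ] ⟧ ρ
      ≡⟨ ⟦⟧-≡-by-normalise (discVTimesQuartic [ quarticₑ ]) identityₑ refl ρ ⟩
    ⟦ identityₑ ⟧ ρ
      ≡⟨⟩
    ⟦ con (+ 2) :^ 8 ⟧ ρ * ⟦ Z :^ 16 ⟧ ρ * ⟦ discEₑ ⟧ ρ + ⟦ weierstrassDefect ⟧ ρ * ⟦ defectCofactor ⟧ ρ
      ≡⟨ cong₂ (λ c w → c * w * ⟦ discEₑ ⟧ ρ + ⟦ weierstrassDefect ⟧ ρ * ⟦ defectCofactor ⟧ ρ)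
               (⟦:^⟧ (con (+ 2)) 8 ρ) (⟦:^⟧ Z 16 ρ) ⟩
    (+ 2) ^ 8 * z ^ 16 * ⟦ discEₑ ⟧ ρ + ⟦ weierstrassDefect ⟧ ρ * ⟦ defectCofactor ⟧ ρ
      ≡⟨ cong (λ d → (+ 2) ^ 8 * z ^ 16 * d + ⟦ weierstrassDefect ⟧ ρ * ⟦ defectCofactor ⟧ ρ)
              {x = ⟦ discEₑ ⟧ ρ} {y = discE a₁ a₂ a₃ a₄ a₆} refl ⟩
    (+ 2) ^ 8 * z ^ 16 * discE a₁ a₂ a₃ a₄ a₆ + ⟦ weierstrassDefect ⟧ ρ * ⟦ defectCofactor ⟧ ρ ∎
    where
    open ≡-Reasoning
    identityₑ : Expr 8
    identityₑ = con (+ 2) :^ 8 :* Z :^ 16 :* discEₑ :+ weierstrassDefect :* defectCofactor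

  weierstrassDefect≡0 : OnCurve a₁ a₂ a₃ a₄ a₆ x y z → ⟦ weierstrassDefect ⟧ ρ ≡ + 0
  weierstrassDefect≡0 onCurve = trans (cong (_- rhs) onCurve) (ℤ.+-inverseʳ rhs)
    where
    rhs = x * x * x + a₂ * x * x * z + a₄ * x * z * z + a₆ * z * z * z

  discT-onCurve : OnCurve a₁ a₂ a₃ a₄ a₆ x y z →
    discT a₁ a₂ a₃ a₄ a₆ x y z ≡ (+ 2) ^ 8 * z ^ 16 * discE a₁ a₂ a₃ a₄ a₆
  discT-onCurve onCurve = begin
    discT a₁ a₂ a₃ a₄ a₆ x y z
      ≡⟨ discT≡2⁸z¹⁶discE+defect*cofactor ⟩
    (+ 2) ^ 8 * z ^ 16 * discE a₁ a₂ a₃ a₄ a₆ + ⟦ weierstrassDefect ⟧ ρ * ⟦ defectCofactor ⟧ ρ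
      ≡⟨ cong (λ d → (+ 2) ^ 8 * z ^ 16 * discE a₁ a₂ a₃ a₄ a₆ + d * ⟦ defectCofactor ⟧ ρ)
              (weierstrassDefect≡0 onCurve) ⟩
    (+ 2) ^ 8 * z ^ 16 * discE a₁ a₂ a₃ a₄ a₆ + + 0
      ≡⟨ ℤ.+-identityʳ _ ⟩
    (+ 2) ^ 8 * z ^ 16 * discE a₁ a₂ a₃ a₄ a₆ ∎
    where open ≡-Reasoning

prime∣∣i^n∣⇒prime∣∣i∣ : ∀ {p} → Prime p → ∀ i n → p ∣ ∣ i ^ n ∣ → p ∣ ∣ i ∣
prime∣∣i^n∣⇒prime∣∣i∣ p-prime i zero    p∣1 rewrite ∣1⇒≡1 p∣1 with p-prime
... | ()
prime∣∣i^n∣⇒prime∣∣i∣ p-prime i (suc n) p∣i*iⁿ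
  rewrite ℤ.abs-* i (i ^ n) with euclidsLemma ∣ i ∣ ∣ i ^ n ∣ p-prime p∣i*iⁿ
... | inj₁ p∣i  = p∣i
... | inj₂ p∣iⁿ = prime∣∣i^n∣⇒prime∣∣i∣ p-prime i n p∣iⁿ

isUnitSInv-2^k*z^n*Δ : ∀ {S z Δ} k n → IsSUnit S z → ¬ (Δ ≡ + 0) →
                       IsUnitSInv S (+ 2 * Δ) ((+ 2) ^ k * z ^ n * Δ)
isUnitSInv-2^k*z^n*Δ {S} {z} {Δ} k n (z≢0 , z-S-unit) Δ≢0 = nonzero , prime-divisors
  where
  nonzero : ¬ ((+ 2) ^ k * z ^ n * Δ ≡ + 0)
  nonzero eq with ℤ.i*j≡0⇒i≡0∨j≡0 ((+ 2) ^ k * z ^ n) eq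
  ... | inj₂ Δ≡0 = Δ≢0 Δ≡0
  ... | inj₁ 2ᵏzⁿ≡0 with ℤ.i*j≡0⇒i≡0∨j≡0 ((+ 2) ^ k) 2ᵏzⁿ≡0
  ...   | inj₁ 2ᵏ≡0 with ℤ.i^n≡0⇒i≡0 (+ 2) k 2ᵏ≡0
  ...     | ()
  nonzero eq | inj₁ 2ᵏzⁿ≡0 | inj₂ zⁿ≡0 = z≢0 (ℤ.i^n≡0⇒i≡0 z n zⁿ≡0)
  prime-divisors : ∀ p → Prime p → p ∣ ∣ (+ 2) ^ k * z ^ n * Δ ∣ → p ∈ S ⊎ p ∣ ∣ + 2 * Δ ∣
  prime-divisors p p-prime p∣D
    rewrite ℤ.abs-* ((+ 2) ^ k * z ^ n) Δ | ℤ.abs-* ((+ 2) ^ k) (z ^ n) | ℤ.abs-* (+ 2) Δ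
    with euclidsLemma (∣ (+ 2) ^ k ∣ ℕ.* ∣ z ^ n ∣) ∣ Δ ∣ p-prime p∣D
  ... | inj₂ p∣Δ = inj₂ (∣-trans p∣Δ (n∣m*n 2))
  ... | inj₁ p∣2ᵏzⁿ with euclidsLemma ∣ (+ 2) ^ k ∣ ∣ z ^ n ∣ p-prime p∣2ᵏzⁿ
  ...   | inj₁ p∣2ᵏ = inj₂ (∣-trans (prime∣∣i^n∣⇒prime∣∣i∣ p-prime (+ 2) k p∣2ᵏ) (m∣m*n ∣ Δ ∣))
  ...   | inj₂ p∣zⁿ = inj₁ (z-S-unit p p-prime (prime∣∣i^n∣⇒prime∣∣i∣ p-prime z n p∣zⁿ))

proposition2p2 : (a₁ a₂ a₃ a₄ a₆ : ℤ) → ¬ (discE a₁ a₂ a₃ a₄ a₆ ≡ + 0)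
    → (S : List ℕ) → All Prime S
    → (x y z : ℤ) → RelPrime3 x y z → OnCurve a₁ a₂ a₃ a₄ a₆ x y z
    → IsSUnit S z
    → IsUnitSInv S (+ 2 * discE a₁ a₂ a₃ a₄ a₆) (discT a₁ a₂ a₃ a₄ a₆ x y z)
proposition2p2 a₁ a₂ a₃ a₄ a₆ Δ≢0 S _ x y z _ onCurve z-S-unit =
  subst (IsUnitSInv S (+ 2 * discE a₁ a₂ a₃ a₄ a₆))
        (sym (discT-onCurve a₁ a₂ a₃ a₄ a₆ x y z onCurve))
        (isUnitSInv-2^k*z^n*Δ 8 16 z-S-unit Δ≢0)
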